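{- For every $n\ge0$, there is a one-to-one correspondence between the set of chains in plane trees with $n$ edges and the set of tricolored plane trees with $n$ edges.
   Context: A plane tree is a rooted tree with linearly ordered children. A chain in a plane tree is a nonempty set of vertices all lying on a single path from the root to a leaf; chains in plane trees with $n$ edges are pairs $(T,Q)$ with $T$ a plane tree with $n$ edges and $Q$ a chain of $T$. A tricolored plane tree is a plane tree in which each child of the root is colored with one of three colors (no other vertex is colored). -}

module Defs where

open import Data.Nat using (ℕ; zero; suc; _+_)
open import Data.Bool using (Bool; true; false; _∧_; _∨_; not)
open import Data.List using (List; []; _∷_; length)
open import Data.Vec using (Vec)
open import Data.Fin using (Fin)
open import Data.Product using (Σ; _×_)
open import Relation.Binary.PropositionalEquality using (_≡_)

data Tree : Set where
  node : List Tree → Tree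

mutual
  edges : Tree → ℕ
  edges (node ts) = edgesList ts

  edgesList : List Tree → ℕ
  edgesList []       = zero
  edgesList (t ∷ ts) = suc (edges t + edgesList ts)

-- A set of vertices of a tree t: one Boolean (membership) per vertex,
-- arranged in the shape of t.
mutual
  data VSet : Tree → Set where
    mk : ∀ {ts} → Bool → VSets ts → VSet (node ts)

  data VSets : List Tree → Set where
    []  : VSets []
    _∷_ : ∀ {t ts} → VSet t → VSets ts → VSets (t ∷ ts)

mutual
  nonempty : ∀ {t} → VSet t → Bool
  nonempty (mk b ms) = b ∨ nonemptys ms

  nonemptys : ∀ {ts} → VSets ts → Bool
  nonemptys []       = false
  nonemptys (m ∷ ms) = nonempty m ∨ nonemptys ms

-- The set lies on a single path from the root to a leaf: at every vertex,
-- at most one child subtree contains vertices of the set, and recursively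
-- so inside that subtree.
mutual
  onPath : ∀ {t} → VSet t → Bool
  onPath (mk b ms) = atMostOneNonempty ms ∧ allOnPath ms

  allOnPath : ∀ {ts} → VSets ts → Bool
  allOnPath []       = true
  allOnPath (m ∷ ms) = onPath m ∧ allOnPath ms

  atMostOneNonempty : ∀ {ts} → VSets ts → Bool
  atMostOneNonempty []       = true
  atMostOneNonempty (m ∷ ms) =
    (not (nonempty m) ∨ not (nonemptys ms)) ∧ atMostOneNonempty ms

IsChain : ∀ {t} → VSet t → Set
IsChain m = (nonempty m ∧ onPath m) ≡ true

ChainsInPlaneTrees : ℕ → Set
ChainsInPlaneTrees n = Σ Tree (λ t → edges t ≡ n × Σ (VSet t) IsChain)

-- Tricolored plane trees with n edges: a plane tree (given by the list of
-- subtrees of its root) together with a colour in Fin 3 for each child of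
-- the root.
TricoloredPlaneTrees : ℕ → Set
TricoloredPlaneTrees n =
  Σ (List Tree) (λ ts → edges (node ts) ≡ n × Vec (Fin 3) (length ts))

module Submission where

open import Defs
open import Data.Nat using (ℕ; zero; suc; _+_)
open import Data.Nat.Properties using (+-comm)
open import Data.Bool using (Bool; true; false; _∧_; _∨_; not)
open import Data.Bool.Properties using (∨-zeroʳ; ∨-conicalˡ; ∨-conicalʳ)
import Data.Bool.Properties as Bool
open import Data.List using (List; []; _∷_; length)
open import Data.Vec using (Vec; []; _∷_)
open import Data.Fin using (Fin; zero; suc)
open import Data.Product using (Σ; _×_; _,_; proj₁; proj₂)
open import Data.Product.Function.Dependent.Propositional using (Σ-↔)
open import Relation.Binary.PropositionalEquality
  using (_≡_; refl; sym; cong; cong₂; subst; module ≡-Reasoning)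
open import Axiom.UniquenessOfIdentityProofs using (module Decidable⇒UIP)
open import Function.Bundles using (_⤖_; _↔_; mk↔ₛ′; Inverse)
open import Function.Properties.Inverse using (↔⇒⤖; ↔-refl)
open import Function.Related.Propositional using (module EquationalReasoning)

-- Follow the path from the root down to the deepest vertex of the chain and
-- list children level by level.  At each vertex of the path, the subtrees left
-- of the path child are listed with colour 0; the path child and its right
-- siblings are replaced by a single new child whose subtrees are those right
-- siblings, coloured 1 or 2 according to whether the vertex lies in the chain;
-- the listing then continues with the children of the path child.  The
-- children of the deepest chain vertex all get colour 0.  Every edge is kept
-- (the edge into the path child becomes the edge into the new child), and the
-- colours 1 and 2 record the steps down the path, so the chain is recovered.

∧-true : ∀ {a b} → a ∧ b ≡ true → (a ≡ true) × (b ≡ true)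
∧-true {true} {true} _ = refl , refl

MarkedTree : Set
MarkedTree = Σ Tree VSet

mutual
  emptyV : ∀ t → VSet t
  emptyV (node ts) = mk false (emptyVs ts)

  emptyVs : ∀ ts → VSets ts
  emptyVs []       = []
  emptyVs (t ∷ ts) = emptyV t ∷ emptyVs ts

mutual
  nonempty-emptyV : ∀ t → nonempty (emptyV t) ≡ false
  nonempty-emptyV (node ts) = nonemptys-emptyVs ts

  nonemptys-emptyVs : ∀ ts → nonemptys (emptyVs ts) ≡ false
  nonemptys-emptyVs []       = refl
  nonemptys-emptyVs (t ∷ ts) rewrite nonempty-emptyV t = nonemptys-emptyVs ts

mutual
  onPath-emptyV : ∀ t → onPath (emptyV t) ≡ true
  onPath-emptyV (node ts)
    rewrite atMostOneNonempty-emptyVs ts | allOnPath-emptyVs ts = refl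

  allOnPath-emptyVs : ∀ ts → allOnPath (emptyVs ts) ≡ true
  allOnPath-emptyVs []       = refl
  allOnPath-emptyVs (t ∷ ts) rewrite onPath-emptyV t = allOnPath-emptyVs ts

  atMostOneNonempty-emptyVs : ∀ ts → atMostOneNonempty (emptyVs ts) ≡ true
  atMostOneNonempty-emptyVs []       = refl
  atMostOneNonempty-emptyVs (t ∷ ts)
    rewrite nonempty-emptyV t = atMostOneNonempty-emptyVs ts

mutual
  nonempty-false⇒emptyV : ∀ {t} (m : VSet t) → nonempty m ≡ false → m ≡ emptyV t
  nonempty-false⇒emptyV (mk b ms) e
    rewrite ∨-conicalˡ b _ e = cong (mk false) (nonemptys-false⇒emptyVs ms (∨-conicalʳ b _ e))

  nonemptys-false⇒emptyVs : ∀ {ts} (ms : VSets ts) → nonemptys ms ≡ false → ms ≡ emptyVs ts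
  nonemptys-false⇒emptyVs []       _ = refl
  nonemptys-false⇒emptyVs (m ∷ ms) e =
    cong₂ _∷_ (nonempty-false⇒emptyV m (∨-conicalˡ _ _ e))
              (nonemptys-false⇒emptyVs ms (∨-conicalʳ _ _ e))

-- A walk describes the children of a vertex of the path: stop ends them at
-- the deepest chain vertex, skip t w puts an unmarked subtree t first, and
-- descend b R w fixes the membership b of the vertex and makes its children
-- the path child described by w followed by the unmarked subtrees R.
data Walk : Set where
  stop    : Walk
  skip    : Tree → Walk → Walk
  descend : Bool → List Tree → Walk → Walk

children : Walk → List Tree
children stop            = []
children (skip t w)      = t ∷ children w
children (descend _ R w) = node (children w) ∷ R

rootMark : Walk → Bool
rootMark stop            = true
rootMark (skip _ w)      = rootMark w
rootMark (descend b _ _) = b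

marks : (w : Walk) → VSets (children w)
marks stop            = []
marks (skip t w)      = emptyV t ∷ marks w
marks (descend _ R w) = mk (rootMark w) (marks w) ∷ emptyVs R

marked : Walk → MarkedTree
marked w = node (children w) , mk (rootMark w) (marks w)

walkSize : Walk → ℕ
walkSize stop            = zero
walkSize (skip t w)      = suc (edges t + walkSize w)
walkSize (descend _ R w) = suc (edgesList R + walkSize w)

edges-marked : ∀ w → edges (proj₁ (marked w)) ≡ walkSize w
edges-marked stop            = refl
edges-marked (skip t w)      = cong (λ k → suc (edges t + k)) (edges-marked w)
edges-marked (descend _ R w) = cong suc (begin
  edgesList (children w) + edgesList R ≡⟨ +-comm (edgesList (children w)) _ ⟩
  edgesList R + edgesList (children w) ≡⟨ cong (edgesList R +_) (edges-marked w) ⟩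
  edgesList R + walkSize w             ∎)
  where open ≡-Reasoning

nonempty-marked : ∀ w → nonempty (proj₂ (marked w)) ≡ true
nonempty-marked stop = refl
nonempty-marked (skip t w) rewrite nonempty-emptyV t = nonempty-marked w
nonempty-marked (descend b R w) rewrite nonempty-marked w = ∨-zeroʳ b

onPath-marked : ∀ w → onPath (proj₂ (marked w)) ≡ true
onPath-marked stop = refl
onPath-marked (skip t w)
  rewrite nonempty-emptyV t | onPath-emptyV t = onPath-marked w
onPath-marked (descend b R w)
  rewrite nonempty-marked w | nonemptys-emptyVs R | onPath-marked w
        | atMostOneNonempty-emptyVs R | allOnPath-emptyVs R = refl

isChain-marked : ∀ w → IsChain (proj₂ (marked w))
isChain-marked w rewrite nonempty-marked w | onPath-marked w = refl

mutual
  walk : ∀ {t} → VSet t → Walk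
  walk (mk b ms) = walkFrom b ms

  walkFrom : Bool → ∀ {ts} → VSets ts → Walk
  walkFrom b [] = stop
  walkFrom b (_∷_ {t} {ts} m ms) with nonempty m
  ... | true  = descend b ts (walk m)
  ... | false = skip t (walkFrom b ms)

walk-marked : ∀ w → walk (proj₂ (marked w)) ≡ w
walk-marked stop = refl
walk-marked (skip t w) rewrite nonempty-emptyV t = cong (skip t) (walk-marked w)
walk-marked (descend b R w)
  rewrite nonempty-marked w = cong (descend b R) (walk-marked w)

skipMarked : Tree → MarkedTree → MarkedTree
skipMarked t (node ts , mk b ms) = node (t ∷ ts) , mk b (emptyV t ∷ ms)

descendMarked : Bool → List Tree → MarkedTree → MarkedTree
descendMarked b R (t , m) = node (t ∷ R) , mk b (m ∷ emptyVs R)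

mutual
  marked-walk : ∀ {t} (m : VSet t) → IsChain m → marked (walk m) ≡ (t , m)
  marked-walk (mk b ms) chain
    with ∧-true {b ∨ nonemptys ms} chain
  ... | nonempty-m , onPath-m
    with ∧-true {atMostOneNonempty ms} onPath-m
  ... | atMostOne , allOnPath-ms = marked-walkFrom b ms nonempty-m atMostOne allOnPath-ms

  marked-walkFrom : ∀ b {ts} (ms : VSets ts) → b ∨ nonemptys ms ≡ true →
                    atMostOneNonempty ms ≡ true → allOnPath ms ≡ true →
                    marked (walkFrom b ms) ≡ (node ts , mk b ms)
  marked-walkFrom true [] _ _ _ = refl
  marked-walkFrom b (_∷_ {t} {ts} m ms) nonempty-b∷ms atMostOne allOnPath-m∷ms
    with nonempty m in nonempty-m
       | ∧-true {not (nonempty m) ∨ not (nonemptys ms)} atMostOne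
       | ∧-true {onPath m} allOnPath-m∷ms
  ... | true | rest-empty , _ | onPath-m , _
    rewrite nonemptys-false⇒emptyVs ms (Bool.not-injective rest-empty)
    = cong (descendMarked b ts)
        (marked-walk m (cong₂ _∧_ nonempty-m onPath-m))
  ... | false | _ , atMostOne-ms | _ , allOnPath-ms
    rewrite nonempty-false⇒emptyV m nonempty-m
    = cong (skipMarked t) (marked-walkFrom b ms nonempty-b∷ms atMostOne-ms allOnPath-ms)

ColouredChildren : Set
ColouredChildren = Σ (List Tree) (λ ts → Vec (Fin 3) (length ts))

membershipColour : Bool → Fin 3
membershipColour false = suc zero
membershipColour true  = suc (suc zero)

colour : Walk → ColouredChildren
colour stop            = [] , []
colour (skip t w)      = t ∷ proj₁ (colour w) , zero ∷ proj₂ (colour w)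
colour (descend b R w) = node R ∷ proj₁ (colour w) , membershipColour b ∷ proj₂ (colour w)

uncolour : (ts : List Tree) → Vec (Fin 3) (length ts) → Walk
uncolour []            []                    = stop
uncolour (t ∷ ts)      (zero ∷ cs)           = skip t (uncolour ts cs)
uncolour (node R ∷ ts) (suc zero ∷ cs)       = descend false R (uncolour ts cs)
uncolour (node R ∷ ts) (suc (suc zero) ∷ cs) = descend true R (uncolour ts cs)

uncolour-colour : ∀ w → uncolour (proj₁ (colour w)) (proj₂ (colour w)) ≡ w
uncolour-colour stop                = refl
uncolour-colour (skip t w)          = cong (skip t) (uncolour-colour w)
uncolour-colour (descend false R w) = cong (descend false R) (uncolour-colour w)
uncolour-colour (descend true R w)  = cong (descend true R) (uncolour-colour w)

colour-uncolour : ∀ ts cs → colour (uncolour ts cs) ≡ (ts , cs)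
colour-uncolour []            []                    = refl
colour-uncolour (t ∷ ts)      (zero ∷ cs)           rewrite colour-uncolour ts cs = refl
colour-uncolour (node R ∷ ts) (suc zero ∷ cs)       rewrite colour-uncolour ts cs = refl
colour-uncolour (node R ∷ ts) (suc (suc zero) ∷ cs) rewrite colour-uncolour ts cs = refl

edges-colour : ∀ w → edgesList (proj₁ (colour w)) ≡ walkSize w
edges-colour stop            = refl
edges-colour (skip t w)      = cong (λ k → suc (edges t + k)) (edges-colour w)
edges-colour (descend _ R w) = cong (λ k → suc (edgesList R + k)) (edges-colour w)

walk↔colouredChildren : Walk ↔ ColouredChildren
walk↔colouredChildren = mk↔ₛ′ colour (λ y → uncolour (proj₁ y) (proj₂ y))
  (λ y → colour-uncolour (proj₁ y) (proj₂ y)) uncolour-colour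

ChainedTree : Set
ChainedTree = Σ MarkedTree (λ s → IsChain (proj₂ s))

chainedTree-≡ : {s s′ : MarkedTree} {c : IsChain (proj₂ s)} {c′ : IsChain (proj₂ s′)} →
                s ≡ s′ → (s , c) ≡ (s′ , c′)
chainedTree-≡ {s} refl = cong (s ,_) (Decidable⇒UIP.≡-irrelevant Bool._≟_ _ _)

walk↔chainedTree : Walk ↔ ChainedTree
walk↔chainedTree = mk↔ₛ′ (λ w → marked w , isChain-marked w) (λ x → walk (proj₂ (proj₁ x)))
  (λ { ((t , m) , chain) → chainedTree-≡ (marked-walk m chain) })
  walk-marked

Σ-↔-sized : ∀ {A B : Set} (sizeA : A → ℕ) (sizeB : B → ℕ) (e : A ↔ B) →
            (∀ x → sizeB (Inverse.to e x) ≡ sizeA x) →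
            ∀ n → Σ A (λ x → sizeA x ≡ n) ↔ Σ B (λ y → sizeB y ≡ n)
Σ-↔-sized sizeA sizeB e preserves n =
  Σ-↔ e (λ {x} → subst (λ k → (sizeA x ≡ n) ↔ (k ≡ n)) (sym (preserves x)) ↔-refl)

chainsInPlaneTrees↔ : ∀ n →
  ChainsInPlaneTrees n ↔ Σ ChainedTree (λ x → edges (proj₁ (proj₁ x)) ≡ n)
chainsInPlaneTrees↔ n = mk↔ₛ′ (λ { (t , p , m , c) → ((t , m) , c) , p })
                               (λ { (((t , m) , c) , p) → t , p , m , c })
                               (λ _ → refl) (λ _ → refl)

tricoloredPlaneTrees↔ : ∀ n →
  TricoloredPlaneTrees n ↔ Σ ColouredChildren (λ y → edgesList (proj₁ y) ≡ n)
tricoloredPlaneTrees↔ n = mk↔ₛ′ (λ { (ts , p , cs) → (ts , cs) , p })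
                                 (λ { ((ts , cs) , p) → ts , p , cs })
                                 (λ _ → refl) (λ _ → refl)

theorem5p2 : (n : ℕ) → ChainsInPlaneTrees n ⤖ TricoloredPlaneTrees n
theorem5p2 n = ↔⇒⤖ (begin
  ChainsInPlaneTrees n
    ↔⟨ chainsInPlaneTrees↔ n ⟩
  Σ ChainedTree (λ x → edges (proj₁ (proj₁ x)) ≡ n)
    ↔⟨ Σ-↔-sized walkSize (λ x → edges (proj₁ (proj₁ x))) walk↔chainedTree edges-marked n ⟨
  Σ Walk (λ w → walkSize w ≡ n)
    ↔⟨ Σ-↔-sized walkSize (λ y → edgesList (proj₁ y)) walk↔colouredChildren edges-colour n ⟩
  Σ ColouredChildren (λ y → edgesList (proj₁ y) ≡ n)
    ↔⟨ tricoloredPlaneTrees↔ n ⟨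
  TricoloredPlaneTrees n
    ∎)
  where open EquationalReasoning
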